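{- Let $G$ be a simple signed digraph having no vertex of in-degree $0$ and no vertex of in-degree $2$. Then at least one Boolean network on $G$ is not synchronizing.
   Context: A signed digraph $G$ on a finite vertex set $V$ is a pair $(V,E)$ with $E\subseteq V\times V\times\{ -1,1\}$; $(j,i,s)\in E$ is an arc from $j$ to $i$ of sign $s$ (loops allowed). $G$ is simple if it never has both a positive and a negative arc from one vertex to another. In-degree refers to the underlying unsigned digraph. A Boolean network (BN) with component set $V$ is a map $f:\{0,1\}^V\to\{0,1\}^V$. Its signed interaction digraph has a positive (resp. negative) arc from $j$ to $i$ iff there is $x$ with $x_j=0$ and $f_i(x+e_j)-f_i(x)>0$ (resp. $<0$), $x+e_j$ being $x$ with component $j$ flipped. A BN on $G$ is one whose signed interaction digraph is $G$. $f^i(x)$ equals $x$ except its $i$-th component is $f_i(x)$; for a word $w=i_1\dots i_\ell$ over $V$, $f^w=f^{i_\ell}\circ\cdots\circ f^{i_1}$. $f$ is synchronizing if $f^w$ is a constant map for some word $w$. -}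

module Defs where

open import Data.Nat using (ℕ)
open import Data.Bool using (Bool; true; false; not; _∨_; T)
open import Data.Bool using (T?)
open import Data.Fin using (Fin)
open import Data.Vec using (Vec; lookup; _[_]≔_; _[_]%=_; count; allFin)
open import Data.List using (List; []; _∷_)
open import Data.Product using (Σ; ∃; _×_; _,_)
open import Relation.Binary.PropositionalEquality using (_≡_)
open import Function.Bundles using (_⇔_)
open import Relation.Nullary using (¬_)

-- A signed digraph on vertex set Fin n, given by its positive and negative
-- arcs: pos j i = true iff (j,i,+1) ∈ E; neg j i = true iff (j,i,-1) ∈ E.
record SignedDigraph (n : ℕ) : Set where
  field
    pos : Fin n → Fin n → Bool
    neg : Fin n → Fin n → Bool
open SignedDigraph public

Simple : {n : ℕ} → SignedDigraph n → Set
Simple G = ∀ j i → ¬ (pos G j i ≡ true × neg G j i ≡ true)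

arc : {n : ℕ} → SignedDigraph n → Fin n → Fin n → Bool
arc G j i = pos G j i ∨ neg G j i

indeg : {n : ℕ} → SignedDigraph n → Fin n → ℕ
indeg G i = count (λ j → T? (arc G j i)) (allFin _)

Config : ℕ → Set
Config n = Vec Bool n

BN : ℕ → Set
BN n = Config n → Config n

flipAt : {n : ℕ} → Config n → Fin n → Config n
flipAt x j = x [ j ]%= not

PosArc : {n : ℕ} → BN n → Fin n → Fin n → Set
PosArc f j i = ∃ λ x → lookup x j ≡ false
                     × lookup (f x) i ≡ false × lookup (f (flipAt x j)) i ≡ true

NegArc : {n : ℕ} → BN n → Fin n → Fin n → Set
NegArc f j i = ∃ λ x → lookup x j ≡ false
                     × lookup (f x) i ≡ true × lookup (f (flipAt x j)) i ≡ false

IsBNOn : {n : ℕ} → BN n → SignedDigraph n → Set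
IsBNOn f G = ∀ j i → (PosArc f j i ⇔ (pos G j i ≡ true))
                   × (NegArc f j i ⇔ (neg G j i ≡ true))

update : {n : ℕ} → BN n → Fin n → Config n → Config n
update f i x = x [ i ]≔ lookup (f x) i

-- f^w for w = i₁ … i_ℓ : first apply f^{i₁}, ..., last f^{i_ℓ}
updateWord : {n : ℕ} → BN n → List (Fin n) → Config n → Config n
updateWord f [] x = x
updateWord f (i ∷ w) x = updateWord f w (update f i x)

Synchronizing : {n : ℕ} → BN n → Set
Synchronizing {n} f = ∃ λ (w : List (Fin n)) → ∃ λ (c : Config n) →
                        ∀ x → updateWord f w x ≡ c

-- Give every vertex i the local rule maj(x₁, x₂, maj(x₁, x₃, … maj(x₁, x_{k-1}, x_k))) of
-- its k in-neighbours, each input negated when its arc is negative. Nested majorities are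
-- monotone and self-dual, and each input is pivotal for this rule as soon as k ≠ 2, so the
-- network has exactly the signed arcs of G. Self-duality of every local rule makes the
-- network commute with complementing configurations; then f^w(¬c) = ¬f^w(c) for every
-- word w, so f^w is never constant.
module Submission where

open import Defs
open import Data.Nat using (ℕ; _<_)
open import Relation.Binary.PropositionalEquality using (_≢_)
open import Data.Product using (∃; _×_)
open import Relation.Nullary using (¬_)

open import Data.Nat using (zero; suc)
open import Data.Bool
  using (Bool; true; false; not; _∧_; _∨_; _xor_; if_then_else_; T; T?; _≤_; b≤b; f≤t)
open import Data.Bool.Properties
  using ( ≤-minimum; ≤-maximum; ≤-reflexive; ≤-antisym; ∨-zeroʳ; not-¬; not-involutive
        ; not-distribˡ-xor; xor-assoc; xor-same; xor-identityʳ; T-≡)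
open import Data.Empty using (⊥-elim)
open import Data.Fin using (Fin; zero; suc; _≟_)
open import Data.Vec as V using (lookup; tabulate; map; count)
import Data.Vec.Properties as VP
open import Data.Vec.Functional using (Vector; updateAt)
open import Data.Vec.Functional.Properties
  using (updateAt-updates; updateAt-minimal; updateAt-commutes)
open import Data.List as L using (List; []; _∷_; length; filter)
open import Data.List.Membership.Propositional using (_∈_; _∉_)
open import Data.List.Membership.Propositional.Properties
  using (∈-filter⁺; ∈-filter⁻; ∈-allFin)
open import Data.List.Relation.Unary.Any using (here; there)
open import Data.List.Relation.Unary.All as All using (All; []; _∷_)
open import Data.List.Relation.Unary.AllPairs using (_∷_)
open import Data.List.Relation.Unary.Unique.Propositional using (Unique)
open import Data.List.Relation.Unary.Unique.Propositional.Properties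
  using (filter⁺; allFin⁺)
open import Data.Product using (_,_; proj₂)
open import Function using (_∘_; const)
open import Function.Bundles using (_⇔_; mk⇔; Equivalence)
open import Relation.Nullary using (Dec; does; yes; no)
open import Relation.Binary.PropositionalEquality
  using (_≡_; _≗_; refl; sym; trans; cong; subst; subst₂; module ≡-Reasoning)

private
  variable
    n : ℕ

maj : Bool → Bool → Bool → Bool
maj a b c = (a ∧ b) ∨ ((a ∨ b) ∧ c)

maj-cong : ∀ {a a′ b b′ c c′} → a ≡ a′ → b ≡ b′ → c ≡ c′ →
           maj a b c ≡ maj a′ b′ c′
maj-cong refl refl refl = refl

∧-mono-≤ : ∀ {a a′ b b′} → a ≤ a′ → b ≤ b′ → a ∧ b ≤ a′ ∧ b′
∧-mono-≤ f≤t _ = ≤-minimum _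
∧-mono-≤ {true} b≤b q = q
∧-mono-≤ {false} b≤b _ = b≤b

∨-mono-≤ : ∀ {a a′ b b′} → a ≤ a′ → b ≤ b′ → a ∨ b ≤ a′ ∨ b′
∨-mono-≤ f≤t _ = ≤-maximum _
∨-mono-≤ {true} b≤b _ = b≤b
∨-mono-≤ {false} b≤b q = q

maj-mono : ∀ {a a′ b b′ c c′} → a ≤ a′ → b ≤ b′ → c ≤ c′ →
           maj a b c ≤ maj a′ b′ c′
maj-mono p q r = ∨-mono-≤ (∧-mono-≤ p q) (∧-mono-≤ (∨-mono-≤ p q) r)

maj-selfDual : ∀ a b c → maj (not a) (not b) (not c) ≡ not (maj a b c)
maj-selfDual true  true  c = refl
maj-selfDual true  false c = refl
maj-selfDual false true  c = refl
maj-selfDual false false c = refl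

maj-not : ∀ x z → maj x (not x) z ≡ z
maj-not true  z = refl
maj-not false z = refl

maj-true-true : ∀ x → maj x true true ≡ true
maj-true-true true  = refl
maj-true-true false = refl

maj-true-false : ∀ x → maj x true false ≡ x
maj-true-false true  = refl
maj-true-false false = refl

maj-false-same : ∀ x → maj x false x ≡ x
maj-false-same true  = refl
maj-false-same false = refl

maj-false-true : ∀ x → maj false x true ≡ x
maj-false-true true  = refl
maj-false-true false = refl

not≤⇒≡true : ∀ {b} → not b ≤ b → b ≡ true
not≤⇒≡true {true} _ = refl
not≤⇒≡true {false} ()

≤not⇒≡false : ∀ {b} → b ≤ not b → b ≡ false
≤not⇒≡false {false} _ = refl
≤not⇒≡false {true} ()

monotone-switch : (g : Bool → Bool) → (∀ {y y′} → y ≤ y′ → g y ≤ g y′) →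
                  ∀ y {b} → g y ≡ not b → g (not y) ≡ b → b ≡ not y
monotone-switch g g-mono false g₀ g₁ = not≤⇒≡true (subst₂ _≤_ g₀ g₁ (g-mono f≤t))
monotone-switch g g-mono true  g₁ g₀ = ≤not⇒≡false (subst₂ _≤_ g₀ g₁ (g-mono f≤t))

sign-select : ∀ b p q → ¬ (p ≡ true × q ≡ true) →
              ((if b then p else q) ≡ true) ⇔ (p ∨ q ≡ true × b ≡ not q)
sign-select true  true  true  p∧q = ⊥-elim (p∧q (refl , refl))
sign-select true  true  false _   = mk⇔ (λ _ → refl , refl) (λ _ → refl)
sign-select true  false true  _   = mk⇔ (λ ()) (λ { (_ , ()) })
sign-select true  false false _   = mk⇔ (λ ()) (λ { (() , _) })
sign-select false p     true  _   = mk⇔ (λ _ → ∨-zeroʳ p , refl) (λ _ → refl)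
sign-select false p     false _   = mk⇔ (λ ()) (λ { (_ , ()) })

_[_]≔_ : {A : Set} → Vector A n → Fin n → A → Vector A n
v [ j ]≔ y = updateAt v j (const y)

[]≔-cong : ∀ {v w : Vector Bool n} j {y} → v ≗ w → v [ j ]≔ y ≗ w [ j ]≔ y
[]≔-cong {v = v} {w} j v≗w k with k ≟ j
... | yes refl = trans (updateAt-updates k v) (sym (updateAt-updates k w))
... | no k≢j   =
  trans (updateAt-minimal k j v k≢j) (trans (v≗w k) (sym (updateAt-minimal k j w k≢j)))

[]≔-mono : ∀ (v : Vector Bool n) j {y y′} → y ≤ y′ →
           ∀ k → (v [ j ]≔ y) k ≤ (v [ j ]≔ y′) k
[]≔-mono v j {y} {y′} y≤y′ k with k ≟ j
... | yes refl = subst₂ _≤_ (sym (updateAt-updates k v)) (sym (updateAt-updates k v)) y≤y′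
... | no k≢j   =
  ≤-reflexive (trans (updateAt-minimal k j v k≢j) (sym (updateAt-minimal k j v k≢j)))

[]≔-irrelevant : ∀ (v : Vector Bool n) {b j k z y} → b ≢ j → k ≢ b →
                 ((v [ b ]≔ z) [ j ]≔ y) k ≡ (v [ j ]≔ y) k
[]≔-irrelevant v {b} {j} {k} b≢j k≢b =
  trans (updateAt-commutes j b (b≢j ∘ sym) v k) (updateAt-minimal k b _ k≢b)

Monotone : (Vector Bool n → Bool) → Set
Monotone φ = ∀ {v w} → (∀ k → v k ≤ w k) → φ v ≤ φ w

monotone⇒cong : ∀ {φ : Vector Bool n → Bool} → Monotone φ → ∀ {v w} → v ≗ w → φ v ≡ φ w
monotone⇒cong φ-mono v≗w =
  ≤-antisym (φ-mono (≤-reflexive ∘ v≗w)) (φ-mono (≤-reflexive ∘ sym ∘ v≗w))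

Pivotal : (Vector Bool n → Bool) → Fin n → Set
Pivotal φ j = ∃ λ v → ∀ y → φ (v [ j ]≔ y) ≡ y

chain : Fin n → Fin n → List (Fin n) → Vector Bool n → Bool
chain a b []      v = v b
chain a b (c ∷ r) v = maj (v a) (v b) (chain a c r v)

-- The value on the empty list is arbitrary: vertices without in-neighbours are excluded.
localRule : List (Fin n) → Vector Bool n → Bool
localRule []          v = false
localRule (a ∷ [])    v = v a
localRule (a ∷ b ∷ r) v = chain a b r v

chain-mono : ∀ (a b : Fin n) r → Monotone (chain a b r)
chain-mono a b []      v≤w = v≤w b
chain-mono a b (c ∷ r) v≤w = maj-mono (v≤w a) (v≤w b) (chain-mono a c r v≤w)

chain-selfDual : ∀ (a b : Fin n) r v → chain a b r (not ∘ v) ≡ not (chain a b r v)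
chain-selfDual a b []      v = refl
chain-selfDual a b (c ∷ r) v =
  trans (cong (maj (not (v a)) (not (v b))) (chain-selfDual a c r v))
        (maj-selfDual (v a) (v b) (chain a c r v))

chain-local : ∀ (a b : Fin n) r {v w} → All (λ k → v k ≡ w k) (a ∷ b ∷ r) →
              chain a b r v ≡ chain a b r w
chain-local a b []      (_ ∷ v≡w ∷ []) = v≡w
chain-local a b (c ∷ r) (va ∷ vb ∷ vr) = maj-cong va vb (chain-local a c r (va ∷ vr))

chain-true : ∀ (a b : Fin n) r {v} → All (λ k → v k ≡ true) (b ∷ r) → chain a b r v ≡ true
chain-true a b []      (vb ∷ []) = vb
chain-true a b (c ∷ r) {v} (vb ∷ vr) =
  trans (maj-cong {a = v a} refl vb (chain-true a c r vr)) (maj-true-true (v a))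

-- With the other inputs set to 1 and the anchor a to 0, maj(a, b, ·) copies b; setting
-- b = ¬a instead makes it copy its last argument, where induction applies.
chain-pivotal-tail : ∀ (a b : Fin n) r {j} → Unique (a ∷ b ∷ r) → j ∈ b ∷ r →
                     Pivotal (chain a b r) j
chain-pivotal-tail a b []      _ (here refl) = const false , λ _ → updateAt-updates b (const false)
chain-pivotal-tail a b (c ∷ r) ((a≢b ∷ a∉) ∷ b∉ ∷ _) (here refl) = v , pivot
  where
  v : Vector Bool _
  v = const true [ a ]≔ false
  pivot : ∀ y → chain a b (c ∷ r) (v [ b ]≔ y) ≡ y
  pivot y = trans (maj-cong va (updateAt-updates b v) (chain-true a c r rest-true)) (maj-false-true y)
    where
    va : (v [ b ]≔ y) a ≡ false
    va = trans (updateAt-minimal a b v a≢b) (updateAt-updates a (const true))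
    rest-true : All (λ k → (v [ b ]≔ y) k ≡ true) (c ∷ r)
    rest-true = All.zipWith
      (λ (a≢k , b≢k) → trans (updateAt-minimal _ b v (b≢k ∘ sym))
                             (updateAt-minimal _ a (const true) (a≢k ∘ sym)))
      (a∉ , b∉)
chain-pivotal-tail a b (c ∷ r) {j} ((a≢b ∷ a∉) ∷ b∉ ∷ u) (there j∈)
  with chain-pivotal-tail a c r (a∉ ∷ u) j∈
... | v₀ , pivot₀ = v , pivot
  where
  v : Vector Bool _
  v = v₀ [ b ]≔ not (v₀ a)
  a≢j : a ≢ j
  a≢j = All.lookup a∉ j∈
  b≢j : b ≢ j
  b≢j = All.lookup b∉ j∈
  pivot : ∀ y → chain a b (c ∷ r) (v [ j ]≔ y) ≡ y
  pivot y = trans (maj-cong va vb (trans (chain-local a c r agree) (pivot₀ y))) (maj-not (v₀ a) y)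
    where
    va : (v [ j ]≔ y) a ≡ v₀ a
    va = trans (updateAt-minimal a j v a≢j) (updateAt-minimal a b v₀ a≢b)
    vb : (v [ j ]≔ y) b ≡ not (v₀ a)
    vb = trans (updateAt-minimal b j v b≢j) (updateAt-updates b v₀)
    agree : All (λ k → (v [ j ]≔ y) k ≡ (v₀ [ j ]≔ y) k) (a ∷ c ∷ r)
    agree = []≔-irrelevant v₀ b≢j a≢b
          ∷ All.map (λ b≢k → []≔-irrelevant v₀ b≢j (b≢k ∘ sym)) b∉

-- maj(a, 1, 0) copies a, and so does maj(a, 0, z) whenever z copies a.
chain-pivotal-anchor : ∀ (a b c : Fin n) r → Unique (a ∷ b ∷ c ∷ r) →
                       Pivotal (chain a b (c ∷ r)) a
chain-pivotal-anchor a b c [] ((a≢b ∷ a≢c ∷ []) ∷ (b≢c ∷ []) ∷ _) = v , pivot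
  where
  v : Vector Bool _
  v = const false [ b ]≔ true
  pivot : ∀ y → chain a b (c ∷ []) (v [ a ]≔ y) ≡ y
  pivot y = trans (maj-cong (updateAt-updates a v) vb vc) (maj-true-false y)
    where
    vb : (v [ a ]≔ y) b ≡ true
    vb = trans (updateAt-minimal b a v (a≢b ∘ sym)) (updateAt-updates b (const false))
    vc : (v [ a ]≔ y) c ≡ false
    vc = trans (updateAt-minimal c a v (a≢c ∘ sym)) (updateAt-minimal c b (const false) (b≢c ∘ sym))
chain-pivotal-anchor a b c (d ∷ r) ((a≢b ∷ a∉) ∷ b∉ ∷ u)
  with chain-pivotal-anchor a c d r (a∉ ∷ u)
... | v₀ , pivot₀ = v , pivot
  where
  v : Vector Bool _
  v = v₀ [ b ]≔ false
  pivot : ∀ y → chain a b (c ∷ d ∷ r) (v [ a ]≔ y) ≡ y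
  pivot y =
    trans (maj-cong (updateAt-updates a v) vb (trans (chain-local a c (d ∷ r) agree) (pivot₀ y)))
          (maj-false-same y)
    where
    vb : (v [ a ]≔ y) b ≡ false
    vb = trans (updateAt-minimal b a v (a≢b ∘ sym)) (updateAt-updates b v₀)
    agree : All (λ k → (v [ a ]≔ y) k ≡ (v₀ [ a ]≔ y) k) (a ∷ c ∷ d ∷ r)
    agree = []≔-irrelevant v₀ (a≢b ∘ sym) a≢b
          ∷ All.map (λ b≢k → []≔-irrelevant v₀ (a≢b ∘ sym) (b≢k ∘ sym)) b∉

localRule-mono : ∀ (L : List (Fin n)) → Monotone (localRule L)
localRule-mono []          _   = b≤b
localRule-mono (a ∷ [])    v≤w = v≤w a
localRule-mono (a ∷ b ∷ r) v≤w = chain-mono a b r v≤w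

localRule-selfDual : ∀ (L : List (Fin n)) → L ≢ [] →
                     ∀ v → localRule L (not ∘ v) ≡ not (localRule L v)
localRule-selfDual []          L≢[] _ = ⊥-elim (L≢[] refl)
localRule-selfDual (a ∷ [])    _    _ = refl
localRule-selfDual (a ∷ b ∷ r) _    v = chain-selfDual a b r v

localRule-local : ∀ (L : List (Fin n)) {v w} → All (λ k → v k ≡ w k) L →
                  localRule L v ≡ localRule L w
localRule-local []          _          = refl
localRule-local (a ∷ [])    (va ∷ [])  = va
localRule-local (a ∷ b ∷ r) agree      = chain-local a b r agree

localRule-ignores : ∀ (L : List (Fin n)) {j} → j ∉ L →
                    ∀ v y → localRule L (v [ j ]≔ y) ≡ localRule L v
localRule-ignores L {j} j∉L v y =
  localRule-local L (All.tabulate λ {k} k∈L → updateAt-minimal k j v λ { refl → j∉L k∈L })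

localRule-pivotal : ∀ (L : List (Fin n)) {j} → Unique L → length L ≢ 2 → j ∈ L →
                    Pivotal (localRule L) j
localRule-pivotal (a ∷ [])        _ _    (here refl) =
  const false , λ _ → updateAt-updates a (const false)
localRule-pivotal (a ∷ [])        _ _    (there ())
localRule-pivotal (a ∷ b ∷ [])    _ ≢2   _           = ⊥-elim (≢2 refl)
localRule-pivotal (a ∷ b ∷ c ∷ r) u _    (here refl) = chain-pivotal-anchor a b c r u
localRule-pivotal (a ∷ b ∷ c ∷ r) u _    (there j∈)  = chain-pivotal-tail a b (c ∷ r) u j∈

twist : (Fin n → Bool) → Config n → Vector Bool n
twist s x k = lookup x k xor s k

realise : (Fin n → Bool) → Vector Bool n → Config n
realise s v = tabulate λ k → v k xor s k

twist-realise : ∀ (s : Fin n → Bool) v → twist s (realise s v) ≗ v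
twist-realise s v k = begin
  lookup (realise s v) k xor s k ≡⟨ cong (_xor s k) (VP.lookup∘tabulate _ k) ⟩
  (v k xor s k) xor s k          ≡⟨ xor-assoc (v k) (s k) (s k) ⟩
  v k xor (s k xor s k)          ≡⟨ cong (v k xor_) (xor-same (s k)) ⟩
  v k xor false                  ≡⟨ xor-identityʳ (v k) ⟩
  v k                            ∎
  where open ≡-Reasoning

twist-[]≔ : ∀ (s : Fin n → Bool) x j y → twist s (x V.[ j ]≔ y) ≗ twist s x [ j ]≔ (y xor s j)
twist-[]≔ s x j y k with k ≟ j
... | yes refl =
  trans (cong (_xor s k) (VP.lookup∘update k x y)) (sym (updateAt-updates k (twist s x)))
... | no k≢j   =
  trans (cong (_xor s k) (VP.lookup∘update′ k≢j x y)) (sym (updateAt-minimal k j (twist s x) k≢j))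

twist-map-not : ∀ (s : Fin n → Bool) x → twist s (map not x) ≗ not ∘ twist s x
twist-map-not s x k =
  trans (cong (_xor s k) (VP.lookup-map k not x)) (sym (not-distribˡ-xor (lookup x k) (s k)))

-- SignedArc f j i true and SignedArc f j i false unfold to PosArc f j i and NegArc f j i.
SignedArc : BN n → Fin n → Fin n → Bool → Set
SignedArc f j i b = ∃ λ x → lookup x j ≡ false × lookup (f x) i ≡ not b
                          × lookup (f (flipAt x j)) i ≡ b

SwitchesAt : BN n → Fin n → Fin n → Bool → Set
SwitchesAt f j i b = ∃ λ x → lookup (f (x V.[ j ]≔ false)) i ≡ not b
                           × lookup (f (x V.[ j ]≔ true)) i ≡ b

signedArc⇔switchesAt : ∀ {f : BN n} {j i b} → SignedArc f j i b ⇔ SwitchesAt f j i b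
signedArc⇔switchesAt {f = f} {j} {i} {b} = mk⇔ to from
  where
  to : SignedArc f j i b → SwitchesAt f j i b
  to (x , xj , f₀ , f₁) = x , subst (λ z → lookup (f z) i ≡ not b) (sym x≡) f₀
                            , subst (λ z → lookup (f z) i ≡ b) flip≡ f₁
    where
    x≡ : x V.[ j ]≔ false ≡ x
    x≡ = trans (cong (x V.[ j ]≔_) (sym xj)) (VP.[]≔-lookup x j)
    flip≡ : flipAt x j ≡ x V.[ j ]≔ true
    flip≡ = VP.updateAt-cong-local j x (cong not xj)
  from : SwitchesAt f j i b → SignedArc f j i b
  from (x , f₀ , f₁) = x V.[ j ]≔ false , VP.lookup∘update j x false , f₀
                     , subst (λ z → lookup (f z) i ≡ b) (sym (VP.updateAt-updateAt j x)) f₁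

module MonotoneCoordinate (f : BN n) (i : Fin n) {φ : Vector Bool n → Bool} (φ-mono : Monotone φ)
                          (s : Fin n → Bool) (f-i : ∀ x → lookup (f x) i ≡ φ (twist s x)) where

  private
    arc⇔switch : ∀ {j b} → SignedArc f j i b ⇔ SwitchesAt f j i b
    arc⇔switch = signedArc⇔switchesAt {f = f} {i = i}

    f-i-[]≔ : ∀ x j y → lookup (f (x V.[ j ]≔ y)) i ≡ φ (twist s x [ j ]≔ (y xor s j))
    f-i-[]≔ x j y = trans (f-i _) (monotone⇒cong φ-mono (twist-[]≔ s x j y))

  signedArc-sign : ∀ {j b} → SignedArc f j i b → b ≡ not (s j)
  signedArc-sign {j} arc with Equivalence.to arc⇔switch arc
  ... | x , f₀ , f₁ =
    monotone-switch (λ y → φ (twist s x [ j ]≔ y)) (φ-mono ∘ []≔-mono (twist s x) j) (s j)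
                    (trans (sym (f-i-[]≔ x j false)) f₀) (trans (sym (f-i-[]≔ x j true)) f₁)

  signedArc-relevant : ∀ {j b} → (∀ v y → φ (v [ j ]≔ y) ≡ φ v) → ¬ SignedArc f j i b
  signedArc-relevant {j} {b} ignores arc with Equivalence.to arc⇔switch arc
  ... | x , f₀ , f₁ = not-¬ refl (begin
    b                                       ≡⟨ sym f₁ ⟩
    lookup (f (x V.[ j ]≔ true)) i          ≡⟨ f-i-[]≔ x j true ⟩
    φ (twist s x [ j ]≔ not (s j))          ≡⟨ ignores _ _ ⟩
    φ (twist s x)                           ≡⟨ sym (ignores _ _) ⟩
    φ (twist s x [ j ]≔ s j)                ≡⟨ sym (f-i-[]≔ x j false) ⟩
    lookup (f (x V.[ j ]≔ false)) i         ≡⟨ f₀ ⟩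
    not b                                   ∎)
    where open ≡-Reasoning

  pivotal⇒signedArc : ∀ {j} → Pivotal φ j → SignedArc f j i (not (s j))
  pivotal⇒signedArc {j} (v , pivot) =
    Equivalence.from arc⇔switch
      (realise s v , trans (at false) (sym (not-involutive (s j))) , at true)
    where
    at : ∀ y → lookup (f (realise s v V.[ j ]≔ y)) i ≡ y xor s j
    at y = trans (f-i-[]≔ (realise s v) j y)
                 (trans (monotone⇒cong φ-mono ([]≔-cong j (twist-realise s v))) (pivot (y xor s j)))

SelfDual : BN n → Set
SelfDual f = ∀ x → f (map not x) ≡ map not (f x)

update-selfDual : ∀ {f : BN n} → SelfDual f →
                  ∀ i x → update f i (map not x) ≡ map not (update f i x)
update-selfDual {f = f} f-sd i x = begin
  map not x V.[ i ]≔ lookup (f (map not x)) i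
    ≡⟨ cong (λ y → map not x V.[ i ]≔ lookup y i) (f-sd x) ⟩
  map not x V.[ i ]≔ lookup (map not (f x)) i
    ≡⟨ cong (map not x V.[ i ]≔_) (VP.lookup-map i not (f x)) ⟩
  map not x V.[ i ]≔ not (lookup (f x) i)
    ≡⟨ sym (VP.map-[]≔ not x i) ⟩
  map not (update f i x)
    ∎
  where open ≡-Reasoning

updateWord-selfDual : ∀ {f : BN n} → SelfDual f →
                      ∀ w x → updateWord f w (map not x) ≡ map not (updateWord f w x)
updateWord-selfDual         f-sd []      x = refl
updateWord-selfDual {f = f} f-sd (i ∷ w) x =
  trans (cong (updateWord f w) (update-selfDual f-sd i x)) (updateWord-selfDual f-sd w (update f i x))

selfDual⇒¬synchronizing : ∀ {f : BN (suc n)} → SelfDual f → ¬ Synchronizing f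
selfDual⇒¬synchronizing {f = f} f-sd (w , c , f^w≡c) =
  not-¬ refl (trans (cong (λ y → lookup y zero) c≡¬c) (VP.lookup-map zero not c))
  where
  c≡¬c : c ≡ map not c
  c≡¬c = begin
    c                                ≡⟨ f^w≡c (map not c) ⟨
    updateWord f w (map not c)       ≡⟨ updateWord-selfDual f-sd w c ⟩
    map not (updateWord f w c)       ≡⟨ cong (map not) (f^w≡c c) ⟩
    map not c                        ∎
    where open ≡-Reasoning

length-filter-tabulate : ∀ {A : Set} {P : A → Set} (P? : ∀ x → Dec (P x)) (g : Fin n → A) →
                         length (filter P? (L.tabulate g)) ≡ count P? (V.tabulate g)
length-filter-tabulate {n = zero}  P? g = refl
length-filter-tabulate {n = suc n} P? g with does (P? (g zero))
... | true  = cong suc (length-filter-tabulate P? (g ∘ suc))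
... | false = length-filter-tabulate P? (g ∘ suc)

inNeighbours : SignedDigraph n → Fin n → List (Fin n)
inNeighbours {n} G i = filter (λ j → T? (arc G j i)) (L.allFin n)

length-inNeighbours : ∀ (G : SignedDigraph n) i → length (inNeighbours G i) ≡ indeg G i
length-inNeighbours G i = length-filter-tabulate (λ j → T? (arc G j i)) (λ j → j)

∈-inNeighbours : ∀ (G : SignedDigraph n) {i j} → j ∈ inNeighbours G i ⇔ arc G j i ≡ true
∈-inNeighbours G {i} {j} = mk⇔
  (λ j∈ → Equivalence.to T-≡ (proj₂ (∈-filter⁻ P? {xs = L.allFin _} j∈)))
  (λ arc≡true → ∈-filter⁺ P? (∈-allFin j) (Equivalence.from T-≡ arc≡true))
  where
  P? : ∀ k → Dec (T (arc G k i))
  P? k = T? (arc G k i)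

inNeighbours-unique : ∀ (G : SignedDigraph n) i → Unique (inNeighbours G i)
inNeighbours-unique {n} G i = filter⁺ (λ j → T? (arc G j i)) (allFin⁺ n)

negatedInputs : SignedDigraph n → Fin n → Fin n → Bool
negatedInputs G i j = neg G j i

network : SignedDigraph n → BN n
network G x = tabulate λ i → localRule (inNeighbours G i) (twist (negatedInputs G i) x)

network-i : ∀ (G : SignedDigraph n) i x →
            lookup (network G x) i ≡ localRule (inNeighbours G i) (twist (negatedInputs G i) x)
network-i G i x = VP.lookup∘tabulate _ i

network-selfDual : ∀ (G : SignedDigraph n) → (∀ i → indeg G i ≢ 0) → SelfDual (network G)
network-selfDual G indeg≢0 x = trans (VP.tabulate-cong selfDual-i) (VP.tabulate-∘ not _)
  where
  selfDual-i : ∀ i → localRule (inNeighbours G i) (twist (negatedInputs G i) (map not x))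
                   ≡ not (localRule (inNeighbours G i) (twist (negatedInputs G i) x))
  selfDual-i i =
    trans (monotone⇒cong (localRule-mono (inNeighbours G i)) (twist-map-not (negatedInputs G i) x))
          (localRule-selfDual (inNeighbours G i) nonempty (twist (negatedInputs G i) x))
    where
    nonempty : inNeighbours G i ≢ []
    nonempty L≡[] = indeg≢0 i (trans (sym (length-inNeighbours G i)) (cong length L≡[]))

network-signedArc : ∀ (G : SignedDigraph n) → Simple G → (∀ i → indeg G i ≢ 2) →
                    ∀ j i b →
                    SignedArc (network G) j i b ⇔ ((if b then pos G j i else neg G j i) ≡ true)
network-signedArc G simple indeg≢2 j i b = mk⇔ to from
  where
  L : List (Fin _)
  L = inNeighbours G i
  open MonotoneCoordinate (network G) i (localRule-mono L) (negatedInputs G i) (network-i G i)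
  select : ((if b then pos G j i else neg G j i) ≡ true) ⇔ (arc G j i ≡ true × b ≡ not (neg G j i))
  select = sign-select b (pos G j i) (neg G j i) (simple j i)

  to : SignedArc (network G) j i b → (if b then pos G j i else neg G j i) ≡ true
  to a = Equivalence.from select (arc≡true , signedArc-sign a)
    where
    arc≡true : arc G j i ≡ true
    arc≡true with arc G j i in eq
    ... | true  = refl
    ... | false = ⊥-elim (signedArc-relevant (localRule-ignores L j∉L) a)
      where
      j∉L : j ∉ L
      j∉L j∈L with () ← trans (sym eq) (Equivalence.to (∈-inNeighbours G) j∈L)

  from : (if b then pos G j i else neg G j i) ≡ true → SignedArc (network G) j i b
  from e with Equivalence.to select e
  ... | arc≡true , b≡ = subst (SignedArc (network G) j i) (sym b≡)
    (pivotal⇒signedArc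
      (localRule-pivotal L (inNeighbours-unique G i) length≢2 (Equivalence.from (∈-inNeighbours G) arc≡true)))
    where
    length≢2 : length L ≢ 2
    length≢2 len≡2 = indeg≢2 i (trans (sym (length-inNeighbours G i)) len≡2)

proposition1 : (n : ℕ) → 0 < n → (G : SignedDigraph n) → Simple G →
                 (∀ i → indeg G i ≢ 0) → (∀ i → indeg G i ≢ 2) →
                 ∃ λ (f : BN n) → IsBNOn f G × ¬ Synchronizing f
proposition1 (suc n) _ G simple indeg≢0 indeg≢2 =
  network G , isBNOn , selfDual⇒¬synchronizing (network-selfDual G indeg≢0)
  where
  isBNOn : IsBNOn (network G) G
  isBNOn j i = network-signedArc G simple indeg≢2 j i true
             , network-signedArc G simple indeg≢2 j i false
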